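{- If $n$ is a positive integer, then $d_g(K_n)=\lceil n/2\rceil$, and $d_g'(K_n)=\frac{n+1}{2}$ if $n$ is odd and $d_g'(K_n)=\frac{n+2}{2}$ if $n$ is even.
   Context: $K_n$ is the complete graph on $n$ vertices. For a vertex $x$, $N[x]$ denotes its closed neighborhood. The domatic number game on a graph $G$ with palette $[k]=\{1,\dots,k\}$: two players, Alice and Bob, alternately choose a previously unchosen vertex of $G$ and assign it a color from $[k]$, until every vertex has been colored. Let $V_i$ be the set of vertices colored $i$. Alice wins if every $V_i$ ($i\in[k]$) is a dominating set of $G$, i.e. for every vertex $x$ and every color $c\in[k]$ some vertex of $N[x]$ has color $c$; otherwise Bob wins. In the $A$-game Alice moves first; in the $B$-game Bob moves first. The game domatic number $d_g(G)$ is the largest $k$ for which Alice has a winning strategy in the $A$-game with palette $[k]$, and the delayed game domatic number $d_g'(G)$ is the largest $k$ for which Alice has a winning strategy in the $B$-game with palette $[k]$. -}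

module Defs where

open import Data.Nat using (ℕ; _<_)
open import Data.Fin using (Fin; _≟_)
open import Data.Maybe using (Maybe; just; nothing)
open import Data.Product using (Σ; ∃; _×_)
open import Data.Sum using (_⊎_)
open import Relation.Nullary using (¬_; yes; no)
open import Relation.Binary.PropositionalEquality using (_≡_; _≢_)

Graph : ℕ → Set₁
Graph n = Fin n → Fin n → Set

K : (n : ℕ) → Graph n
K n x y = x ≢ y

_∈N[_]_ : ∀ {n} → Fin n → Fin n → Graph n → Set
y ∈N[ x ] G = (y ≡ x) ⊎ G x y

-- A (partial) colouring with palette [k] = Fin k; nothing = uncoloured.
Colouring : ℕ → ℕ → Set
Colouring n k = Fin n → Maybe (Fin k)

empty : ∀ {n k} → Colouring n k
empty _ = nothing

update : ∀ {n k} → Colouring n k → Fin n → Fin k → Colouring n k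
update c v a w with w ≟ v
... | yes _ = just a
... | no  _ = c w

AllColoured : ∀ {n k} → Colouring n k → Set
AllColoured {n} c = ∀ (v : Fin n) → ∃ λ a → c v ≡ just a

AllClassesDominating : ∀ {n k} → Graph n → Colouring n k → Set
AllClassesDominating {n} {k} G c =
  ∀ (x : Fin n) (i : Fin k) → ∃ λ y → (y ∈N[ x ] G) × (c y ≡ just i)

data Player : Set where
  alice bob : Player

data AliceWins {n : ℕ} (G : Graph n) (k : ℕ) : Player → Colouring n k → Set where
  finished : ∀ {p c} → AllColoured c → AllClassesDominating G c → AliceWins G k p c
  aliceMove : ∀ {c} (v : Fin n) (a : Fin k) → c v ≡ nothing →
              AliceWins G k bob (update c v a) → AliceWins G k alice c
  bobMove : ∀ {c} → ¬ AllColoured c →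
            (∀ (v : Fin n) (a : Fin k) → c v ≡ nothing →
               AliceWins G k alice (update c v a)) →
            AliceWins G k bob c

WinsAGame : ∀ {n} → Graph n → ℕ → Set
WinsAGame G k = AliceWins G k alice empty

WinsBGame : ∀ {n} → Graph n → ℕ → Set
WinsBGame G k = AliceWins G k bob empty

IsLargest : (ℕ → Set) → ℕ → Set
IsLargest W d = W d × (∀ k → d < k → ¬ W k)

GameDomaticNumberIs : ∀ {n} → Graph n → ℕ → Set
GameDomaticNumberIs G = IsLargest (WinsAGame G)

DelayedGameDomaticNumberIs : ∀ {n} → Graph n → ℕ → Set
DelayedGameDomaticNumberIs G = IsLargest (WinsBGame G)

{-# OPTIONS --safe #-}
-- In K n every vertex lies in every closed neighbourhood, so a colour class is dominating iff
-- it is non-empty: Alice wins iff every colour gets used.  She can spend each of her remaining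
-- moves on a colour that is still missing, whereas Bob, once some colour has been used, can
-- always repeat it.  So Alice wins a position iff the number of missing colours is at most the
-- number of moves she still makes: ⌈ n /2⌉ in the A-game, and in the B-game, where Bob's first
-- move cannot avoid using a new colour, 1 + ⌈ (n - 1) /2⌉ = 1 + ⌊ n /2⌋.
module Submission where

open import Defs
open import Data.Nat using (ℕ; _≤_; _+_; _/_; _%_; ⌈_/2⌉)
open import Data.Product using (_×_)
open import Relation.Binary.PropositionalEquality using (_≡_)

open import Data.Nat using (zero; suc; _<_; ⌊_/2⌋; NonZero; z≤n; s≤s; s≤s⁻¹; s<s⁻¹)
open import Data.Nat.Properties
open import Data.Nat.DivMod using (m/n≡1+[m∸n]/n)
open import Data.Fin as Fin using (Fin; zero; suc)
open import Data.Fin.Properties using (any?)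
open import Data.Fin.Subset
open import Data.Fin.Subset.Properties
open import Data.Vec using ([]; _∷_; tabulate)
open import Data.Vec.Properties using (lookup∘tabulate; []=⇒lookup; lookup⇒[]=)
open import Data.Bool.Properties using (T-≡)
open import Data.Maybe using (just; nothing)
open import Data.Maybe.Properties using (≡-dec; just-injective)
open import Data.Product using (∃; _,_; proj₁; proj₂; map₂)
open import Data.Sum using (_⊎_; inj₁; inj₂)
open import Function using (_∘_; Equivalence)
open import Relation.Nullary using (¬_; yes; no; ¬?; contradiction)
open import Relation.Nullary.Decidable using (isYes; toWitness; fromWitness; decidable-stable)
open import Relation.Unary using (Pred; Decidable)
open import Relation.Binary.PropositionalEquality
  using (_≢_; refl; sym; trans; cong; subst; subst₂; ≢-sym; module ≡-Reasoning)

n/2≡⌊n/2⌋ : ∀ n → n / 2 ≡ ⌊ n /2⌋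
n/2≡⌊n/2⌋ 0             = refl
n/2≡⌊n/2⌋ 1             = refl
n/2≡⌊n/2⌋ (suc (suc n)) =
  trans (m/n≡1+[m∸n]/n {suc (suc n)} (s≤s (s≤s z≤n))) (cong suc (n/2≡⌊n/2⌋ n))

[n+2]/2≡1+⌊n/2⌋ : ∀ n → (n + 2) / 2 ≡ suc ⌊ n /2⌋
[n+2]/2≡1+⌊n/2⌋ n = trans (n/2≡⌊n/2⌋ (n + 2)) (cong ⌊_/2⌋ (+-comm n 2))

-- The recursive call typechecks because (2 + n) % 2 reduces to n % 2.
odd⇒⌈n/2⌉≡1+⌊n/2⌋ : ∀ n → n % 2 ≡ 1 → ⌈ n /2⌉ ≡ suc ⌊ n /2⌋
odd⇒⌈n/2⌉≡1+⌊n/2⌋ 1             _   = refl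
odd⇒⌈n/2⌉≡1+⌊n/2⌋ (suc (suc n)) odd = cong suc (odd⇒⌈n/2⌉≡1+⌊n/2⌋ n odd)

odd⇒[n+1]/2≡1+⌊n/2⌋ : ∀ n → n % 2 ≡ 1 → (n + 1) / 2 ≡ suc ⌊ n /2⌋
odd⇒[n+1]/2≡1+⌊n/2⌋ n odd = begin
  (n + 1) / 2   ≡⟨ n/2≡⌊n/2⌋ (n + 1) ⟩
  ⌊ n + 1 /2⌋   ≡⟨ cong ⌊_/2⌋ (+-comm n 1) ⟩
  ⌈ n /2⌉       ≡⟨ odd⇒⌈n/2⌉≡1+⌊n/2⌋ n odd ⟩
  suc ⌊ n /2⌋   ∎
  where open ≡-Reasoning

∣p∪q∣≤∣p∣+∣q∣ : ∀ {n} (p q : Subset n) → ∣ p ∪ q ∣ ≤ ∣ p ∣ + ∣ q ∣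
∣p∪q∣≤∣p∣+∣q∣ [] [] = z≤n
∣p∪q∣≤∣p∣+∣q∣ (inside ∷ p) (s ∷ q) =
  s≤s (≤-trans (∣p∪q∣≤∣p∣+∣q∣ p q) (+-monoʳ-≤ ∣ p ∣ (∣p∣≤∣x∷p∣ s q)))
∣p∪q∣≤∣p∣+∣q∣ (outside ∷ p) (inside ∷ q) =
  ≤-trans (s≤s (∣p∪q∣≤∣p∣+∣q∣ p q)) (≤-reflexive (sym (+-suc ∣ p ∣ ∣ q ∣)))
∣p∪q∣≤∣p∣+∣q∣ (outside ∷ p) (outside ∷ q) = ∣p∪q∣≤∣p∣+∣q∣ p q

module _ {n : ℕ} where

  x∈p⇒0<∣p∣ : ∀ {p : Subset n} {x} → x ∈ p → 0 < ∣ p ∣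
  x∈p⇒0<∣p∣ {p} {x} x∈p = ≤-trans (≤-reflexive (sym (∣⁅x⁆∣≡1 x))) (p⊆q⇒∣p∣≤∣q∣ ⁅x⁆⊆p)
    where
    ⁅x⁆⊆p : ⁅ x ⁆ ⊆ p
    ⁅x⁆⊆p y∈⁅x⁆ = subst (_∈ p) (sym (x∈⁅y⁆⇒x≡y x y∈⁅x⁆)) x∈p

  Empty⇒∣p∣≡0 : ∀ {p : Subset n} → Empty p → ∣ p ∣ ≡ 0
  Empty⇒∣p∣≡0 empty = trans (cong ∣_∣ (Empty-unique empty)) (∣⊥∣≡0 n)

  0<∣p∣⇒Nonempty : ∀ {p : Subset n} → 0 < ∣ p ∣ → Nonempty p
  0<∣p∣⇒Nonempty {p} 0<∣p∣ with nonempty? p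
  ... | yes nonempty = nonempty
  ... | no empty     = contradiction (Empty⇒∣p∣≡0 empty) (>⇒≢ 0<∣p∣)

  ⊤⊆p⇒∣p∣≡n : ∀ {p : Subset n} → ⊤ ⊆ p → ∣ p ∣ ≡ n
  ⊤⊆p⇒∣p∣≡n ⊤⊆p = trans (cong ∣_∣ (⊆-antisym ⊆⊤ ⊤⊆p)) (∣⊤∣≡n n)

  p⊆q∪⁅x⁆⇒∣p∣≤1+∣q∣ : ∀ {p q : Subset n} {x} → p ⊆ q ∪ ⁅ x ⁆ → ∣ p ∣ ≤ suc ∣ q ∣
  p⊆q∪⁅x⁆⇒∣p∣≤1+∣q∣ {p} {q} {x} p⊆q∪⁅x⁆ = begin
    ∣ p ∣             ≤⟨ p⊆q⇒∣p∣≤∣q∣ p⊆q∪⁅x⁆ ⟩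
    ∣ q ∪ ⁅ x ⁆ ∣     ≤⟨ ∣p∪q∣≤∣p∣+∣q∣ q ⁅ x ⁆ ⟩
    ∣ q ∣ + ∣ ⁅ x ⁆ ∣ ≡⟨ cong (∣ q ∣ +_) (∣⁅x⁆∣≡1 x) ⟩
    ∣ q ∣ + 1         ≡⟨ +-comm ∣ q ∣ 1 ⟩
    suc ∣ q ∣         ∎
    where open ≤-Reasoning

  p⊂q⊆p∪⁅x⁆⇒∣q∣≡1+∣p∣ : ∀ {p q : Subset n} {x} → p ⊂ q → q ⊆ p ∪ ⁅ x ⁆ → ∣ q ∣ ≡ suc ∣ p ∣
  p⊂q⊆p∪⁅x⁆⇒∣q∣≡1+∣p∣ p⊂q q⊆p∪⁅x⁆ =
    ≤-antisym (p⊆q∪⁅x⁆⇒∣p∣≤1+∣q∣ q⊆p∪⁅x⁆) (p⊂q⇒∣p∣<∣q∣ p⊂q)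

module _ {n ℓ} {P : Pred (Fin n) ℓ} (P? : Decidable P) where

  subsetOf : Subset n
  subsetOf = tabulate (λ x → isYes (P? x))

  ∈-subsetOf⁺ : ∀ {x} → P x → x ∈ subsetOf
  ∈-subsetOf⁺ {x} px =
    lookup⇒[]= x subsetOf (trans (lookup∘tabulate _ x) (Equivalence.to T-≡ (fromWitness px)))

  ∈-subsetOf⁻ : ∀ {x} → x ∈ subsetOf → P x
  ∈-subsetOf⁻ {x} x∈ =
    toWitness (Equivalence.from T-≡ (trans (sym (lookup∘tabulate _ x)) ([]=⇒lookup x∈)))

module _ {n k : ℕ} where

  uncoloured : Colouring n k → Subset n
  uncoloured c = subsetOf (λ v → ≡-dec Fin._≟_ (c v) nothing)

  Used : Colouring n k → Fin k → Set
  Used c i = ∃ λ v → c v ≡ just i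

  used? : ∀ c → Decidable (Used c)
  used? c i = any? (λ v → ≡-dec Fin._≟_ (c v) (just i))

  missing : Colouring n k → Subset k
  missing c = subsetOf (¬? ∘ used? c)

  #uncoloured : Colouring n k → ℕ
  #uncoloured c = ∣ uncoloured c ∣

  #missing : Colouring n k → ℕ
  #missing c = ∣ missing c ∣

  ∈-uncoloured⁺ : ∀ {c v} → c v ≡ nothing → v ∈ uncoloured c
  ∈-uncoloured⁺ = ∈-subsetOf⁺ _

  ∈-uncoloured⁻ : ∀ {c v} → v ∈ uncoloured c → c v ≡ nothing
  ∈-uncoloured⁻ = ∈-subsetOf⁻ _

  ∈-missing⁺ : ∀ {c i} → ¬ Used c i → i ∈ missing c
  ∈-missing⁺ = ∈-subsetOf⁺ _

  ∈-missing⁻ : ∀ {c i} → i ∈ missing c → ¬ Used c i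
  ∈-missing⁻ = ∈-subsetOf⁻ _

  ∉-missing⇒Used : ∀ {c i} → i ∉ missing c → Used c i
  ∉-missing⇒Used {c} {i} i∉missing = decidable-stable (used? c i) (i∉missing ∘ ∈-subsetOf⁺ _)

  update-self : ∀ (c : Colouring n k) v a → update c v a v ≡ just a
  update-self c v a with v Fin.≟ v
  ... | yes _   = refl
  ... | no v≢v = contradiction refl v≢v

  update-other : ∀ (c : Colouring n k) v a {w} → w ≢ v → update c v a w ≡ c w
  update-other c v a {w} w≢v with w Fin.≟ v
  ... | yes w≡v = contradiction w≡v w≢v
  ... | no _    = refl

  update⁻ : ∀ (c : Colouring n k) v a {w m} → update c v a w ≡ m → (w ≡ v × just a ≡ m) ⊎ c w ≡ m
  update⁻ c v a {w} c′w≡m with w Fin.≟ v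
  ... | yes w≡v = inj₁ (w≡v , c′w≡m)
  ... | no _    = inj₂ c′w≡m

  module _ (c : Colouring n k) (v : Fin n) (a : Fin k) where

    uncoloured-update⊂ : c v ≡ nothing → uncoloured (update c v a) ⊂ uncoloured c
    uncoloured-update⊂ v-free = still-free , v , ∈-uncoloured⁺ v-free , v-coloured
      where
      v-coloured : v ∉ uncoloured (update c v a)
      v-coloured v-free′ with () ← trans (sym (update-self c v a)) (∈-uncoloured⁻ v-free′)

      still-free : uncoloured (update c v a) ⊆ uncoloured c
      still-free w-free′ with update⁻ c v a (∈-uncoloured⁻ w-free′)
      ... | inj₁ (_ , ())
      ... | inj₂ cw≡nothing = ∈-uncoloured⁺ cw≡nothing

    uncoloured⊆uncoloured-update∪⁅v⁆ : uncoloured c ⊆ uncoloured (update c v a) ∪ ⁅ v ⁆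
    uncoloured⊆uncoloured-update∪⁅v⁆ {w} w-free with w Fin.≟ v
    ... | yes refl = x∈p∪q⁺ (inj₂ (x∈⁅x⁆ v))
    ... | no w≢v   =
      x∈p∪q⁺ (inj₁ (∈-uncoloured⁺ (trans (update-other c v a w≢v) (∈-uncoloured⁻ w-free))))

    ∉-missing-update : a ∉ missing (update c v a)
    ∉-missing-update a∈missing = ∈-missing⁻ a∈missing (v , update-self c v a)

    missing-update⊆ : c v ≡ nothing → missing (update c v a) ⊆ missing c
    missing-update⊆ v-free {i} i∈missing′ = ∈-missing⁺ unused
      where
      unused : ¬ Used c i
      unused (w , cw≡i) with w Fin.≟ v
      ... | yes refl with () ← trans (sym v-free) cw≡i
      ... | no w≢v   = ∈-missing⁻ i∈missing′ (w , trans (update-other c v a w≢v) cw≡i)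

    missing⊆missing-update∪⁅a⁆ : missing c ⊆ missing (update c v a) ∪ ⁅ a ⁆
    missing⊆missing-update∪⁅a⁆ {i} i∈missing with i Fin.≟ a
    ... | yes refl = x∈p∪q⁺ (inj₂ (x∈⁅x⁆ a))
    ... | no i≢a   = x∈p∪q⁺ (inj₁ (∈-missing⁺ unused))
      where
      unused : ¬ Used (update c v a) i
      unused (w , c′w≡i) with update⁻ c v a c′w≡i
      ... | inj₁ (_ , a≡i) = i≢a (sym (just-injective a≡i))
      ... | inj₂ cw≡i      = ∈-missing⁻ i∈missing (w , cw≡i)

    #uncoloured-update : c v ≡ nothing → #uncoloured c ≡ suc (#uncoloured (update c v a))
    #uncoloured-update v-free =
      p⊂q⊆p∪⁅x⁆⇒∣q∣≡1+∣p∣ (uncoloured-update⊂ v-free) uncoloured⊆uncoloured-update∪⁅v⁆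

    #missing-update≤ : c v ≡ nothing → #missing (update c v a) ≤ #missing c
    #missing-update≤ v-free = p⊆q⇒∣p∣≤∣q∣ (missing-update⊆ v-free)

    #missing-update< : c v ≡ nothing → a ∈ missing c → #missing (update c v a) < #missing c
    #missing-update< v-free a∈missing =
      p⊂q⇒∣p∣<∣q∣ (missing-update⊆ v-free , a , a∈missing , ∉-missing-update)

    #missing≤1+#missing-update : #missing c ≤ suc (#missing (update c v a))
    #missing≤1+#missing-update = p⊆q∪⁅x⁆⇒∣p∣≤1+∣q∣ missing⊆missing-update∪⁅a⁆

    #missing≤#missing-update : a ∉ missing c → #missing c ≤ #missing (update c v a)
    #missing≤#missing-update a∉missing = p⊆q⇒∣p∣≤∣q∣ still-missing
      where
      still-missing : missing c ⊆ missing (update c v a)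
      still-missing i∈missing with x∈p∪q⁻ _ _ (missing⊆missing-update∪⁅a⁆ i∈missing)
      ... | inj₁ i∈missing′ = i∈missing′
      ... | inj₂ i∈⁅a⁆      =
        contradiction (subst (_∈ missing c) (x∈⁅y⁆⇒x≡y a i∈⁅a⁆) i∈missing) a∉missing

  free⇒¬AllColoured : ∀ {c : Colouring n k} {v} → c v ≡ nothing → ¬ AllColoured c
  free⇒¬AllColoured {c} {v} v-free allColoured
    with () ← trans (sym v-free) (proj₂ (allColoured v))

  #uncoloured≡0⇒AllColoured : ∀ {c : Colouring n k} → #uncoloured c ≡ 0 → AllColoured c
  #uncoloured≡0⇒AllColoured {c} none-free v with c v in cv
  ... | just a  = a , refl
  ... | nothing = contradiction none-free (>⇒≢ (x∈p⇒0<∣p∣ (∈-uncoloured⁺ cv)))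

  0<#uncoloured⇒free : ∀ {c : Colouring n k} → 0 < #uncoloured c → ∃ λ v → c v ≡ nothing
  0<#uncoloured⇒free {c} = map₂ ∈-uncoloured⁻ ∘ 0<∣p∣⇒Nonempty {p = uncoloured c}

module _ (n k : ℕ) where

  #uncoloured-empty : #uncoloured (empty {n} {k}) ≡ n
  #uncoloured-empty = ⊤⊆p⇒∣p∣≡n (λ _ → ∈-uncoloured⁺ {c = empty {n} {k}} refl)

  ∈-missing-empty : ∀ {i} → i ∈ missing (empty {n} {k})
  ∈-missing-empty = ∈-missing⁺ (λ ())

  #missing-empty : #missing (empty {n} {k}) ≡ k
  #missing-empty = ⊤⊆p⇒∣p∣≡n {p = missing empty} (λ _ → ∈-missing-empty)

  #uncoloured-update-empty : ∀ (v : Fin n) (a : Fin k) → suc (#uncoloured (update empty v a)) ≡ n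
  #uncoloured-update-empty v a = trans (sym (#uncoloured-update empty v a refl)) #uncoloured-empty

  #missing-update-empty : ∀ (v : Fin n) (a : Fin k) → suc (#missing (update empty v a)) ≡ k
  #missing-update-empty v a = trans
    (≤-antisym (#missing-update< empty v a refl ∈-missing-empty)
               (#missing≤1+#missing-update empty v a))
    #missing-empty

∈N[K] : ∀ {n} (x y : Fin n) → y ∈N[ x ] K n
∈N[K] x y with y Fin.≟ x
... | yes y≡x = inj₁ y≡x
... | no y≢x  = inj₂ (≢-sym y≢x)

module _ {n k : ℕ} {c : Colouring n k} where

  #missing≡0⇒Dominating : #missing c ≡ 0 → AllClassesDominating (K n) c
  #missing≡0⇒Dominating none-missing x i =
    let (y , cy≡i) = ∉-missing⇒Used (λ i∈missing → >⇒≢ (x∈p⇒0<∣p∣ i∈missing) none-missing)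
    in y , ∈N[K] x y , cy≡i

  Dominating⇒#missing≡0 : Fin n → AllClassesDominating (K n) c → #missing c ≡ 0
  Dominating⇒#missing≡0 x dominating = Empty⇒∣p∣≡0 λ (i , i∈missing) →
    let (y , _ , cy≡i) = dominating x i in ∈-missing⁻ i∈missing (y , cy≡i)

-- The number of moves Alice still makes when u vertices are uncoloured and p is to move.
-- The proofs below use that aliceTurns alice (suc u) = suc (aliceTurns bob u) and
-- aliceTurns bob (suc u) = aliceTurns alice u hold definitionally.
aliceTurns : Player → ℕ → ℕ
aliceTurns alice u = ⌈ u /2⌉
aliceTurns bob   u = ⌊ u /2⌋

aliceTurns-0 : ∀ p → aliceTurns p 0 ≡ 0
aliceTurns-0 alice = refl
aliceTurns-0 bob   = refl

module _ {n k : ℕ} where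

  aliceWins : Fin k → ∀ p (c : Colouring n k) →
              #missing c ≤ aliceTurns p (#uncoloured c) → AliceWins (K n) k p c
  aliceWins a₀ p c = go (#uncoloured c) p c refl
    where
    go : ∀ u p (c : Colouring n k) → #uncoloured c ≡ u →
         #missing c ≤ aliceTurns p u → AliceWins (K n) k p c
    go zero p c none-free few-missing = finished (#uncoloured≡0⇒AllColoured none-free)
      (#missing≡0⇒Dominating (n≤0⇒n≡0 (subst (#missing c ≤_) (aliceTurns-0 p) few-missing)))
    go (suc u) p c #free≡1+u few-missing = move p few-missing
      where
      free : ∃ λ v → c v ≡ nothing
      free = 0<#uncoloured⇒free (subst (0 <_) (sym #free≡1+u) (s≤s z≤n))

      #free-after : ∀ {w} a → c w ≡ nothing → #uncoloured (update c w a) ≡ u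
      #free-after {w} a w-free =
        suc-injective (trans (sym (#uncoloured-update c w a w-free)) #free≡1+u)

      move : ∀ p → #missing c ≤ aliceTurns p (suc u) → AliceWins (K n) k p c
      move alice few-missing with free | nonempty? (missing c)
      ... | v , v-free | yes (a , a∈missing) =
        aliceMove v a v-free (go u bob _ (#free-after a v-free)
          (s≤s⁻¹ (≤-trans (#missing-update< c v a v-free a∈missing) few-missing)))
      ... | v , v-free | no none-missing =
        aliceMove v a₀ v-free (go u bob _ (#free-after a₀ v-free)
          (≤-trans (#missing-update≤ c v a₀ v-free)
                   (≤-trans (≤-reflexive (Empty⇒∣p∣≡0 none-missing)) z≤n)))
      move bob few-missing = bobMove (free⇒¬AllColoured (proj₂ free)) λ w a w-free →
        go u alice _ (#free-after a w-free) (≤-trans (#missing-update≤ c w a w-free) few-missing)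

  -- Bob's strategy is to repeat an already used colour; one exists as soon as Alice has moved.
  bobWins : Fin n → ∀ {p} {c : Colouring n k} → p ≡ alice ⊎ ∃ (_∉ missing c) →
            aliceTurns p (#uncoloured c) < #missing c → ¬ AliceWins (K n) k p c
  bobWins x₀ _ many-missing (finished _ dominating) =
    contradiction (Dominating⇒#missing≡0 x₀ dominating) (m<n⇒n≢0 many-missing)
  bobWins x₀ {c = c} _ many-missing (aliceMove v a v-free wins) =
    bobWins x₀ (inj₂ (a , ∉-missing-update c v a)) (s≤s⁻¹ (begin
      suc ⌈ suc (#uncoloured c′) /2⌉
        ≡⟨ cong (suc ∘ ⌈_/2⌉) (sym (#uncoloured-update c v a v-free)) ⟩
      suc ⌈ #uncoloured c /2⌉
        ≤⟨ many-missing ⟩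
      #missing c
        ≤⟨ #missing≤1+#missing-update c v a ⟩
      suc (#missing c′)
        ∎)) wins
    where
    open ≤-Reasoning
    c′ = update c v a
  bobWins x₀ (inj₁ ()) _ (bobMove _ _)
  bobWins x₀ {c = c} (inj₂ (b , b-used)) many-missing (bobMove some-free wins) =
    bobWins x₀ (inj₁ refl) (begin-strict
      ⌈ #uncoloured c′ /2⌉ ≡⟨ cong ⌊_/2⌋ (sym (#uncoloured-update c v b v-free)) ⟩
      ⌊ #uncoloured c /2⌋  <⟨ many-missing ⟩
      #missing c           ≤⟨ #missing≤#missing-update c v b b-used ⟩
      #missing c′          ∎) (wins v b v-free)
    where
    open ≤-Reasoning
    free : ∃ λ v → c v ≡ nothing
    free = 0<#uncoloured⇒free (n≢0⇒n>0 (some-free ∘ #uncoloured≡0⇒AllColoured))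
    v = proj₁ free
    v-free = proj₂ free
    c′ = update c v b

gameDomaticNumber-K : ∀ n .{{_ : NonZero n}} → GameDomaticNumberIs (K n) ⌈ n /2⌉
gameDomaticNumber-K n@(suc _) = aliceWins-A , bobWins-A
  where
  aliceWins-A : WinsAGame (K n) ⌈ n /2⌉
  aliceWins-A = aliceWins zero alice empty
    (≤-reflexive (trans (#missing-empty n ⌈ n /2⌉)
                        (cong ⌈_/2⌉ (sym (#uncoloured-empty n ⌈ n /2⌉)))))

  bobWins-A : ∀ k → ⌈ n /2⌉ < k → ¬ WinsAGame (K n) k
  bobWins-A k ⌈n/2⌉<k = bobWins zero (inj₁ refl)
    (subst₂ _<_ (cong ⌈_/2⌉ (sym (#uncoloured-empty n k))) (sym (#missing-empty n k)) ⌈n/2⌉<k)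

-- Bob's first move is forced to introduce a new colour, leaving Alice to move with n - 1
-- vertices uncoloured and k - 1 colours missing.
delayedGameDomaticNumber-K : ∀ n .{{_ : NonZero n}} →
                             DelayedGameDomaticNumberIs (K n) (suc ⌊ n /2⌋)
delayedGameDomaticNumber-K n@(suc m) = aliceWins-B , bobWins-B
  where
  aliceWins-B : WinsBGame (K n) (suc ⌈ m /2⌉)
  aliceWins-B = bobMove (free⇒¬AllColoured {v = zero} refl) λ v a _ →
    aliceWins zero alice _ (≤-reflexive (trans
      (suc-injective (#missing-update-empty n (suc ⌈ m /2⌉) v a))
      (cong ⌈_/2⌉ (suc-injective (sym (#uncoloured-update-empty n (suc ⌈ m /2⌉) v a))))))

  bobWins-B : ∀ k → suc ⌈ m /2⌉ < k → ¬ WinsBGame (K n) k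
  bobWins-B zero ()
  bobWins-B (suc k) _ (finished allColoured _) = free⇒¬AllColoured {v = zero} refl allColoured
  bobWins-B (suc k) 1+⌈m/2⌉<1+k (bobMove _ wins) = bobWins zero (inj₁ refl)
    (subst₂ _<_ (cong ⌈_/2⌉ (suc-injective (sym (#uncoloured-update-empty n (suc k) zero zero))))
                (suc-injective (sym (#missing-update-empty n (suc k) zero zero)))
                (s<s⁻¹ 1+⌈m/2⌉<1+k))
    (wins zero zero refl)

proposition4p5 : ∀ (n : ℕ) → 1 ≤ n →
    GameDomaticNumberIs (K n) ⌈ n /2⌉
    × (n % 2 ≡ 1 → DelayedGameDomaticNumberIs (K n) ((n + 1) / 2))
    × (n % 2 ≡ 0 → DelayedGameDomaticNumberIs (K n) ((n + 2) / 2))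
proposition4p5 zero ()
proposition4p5 n@(suc _) _ =
    gameDomaticNumber-K n
  , (λ odd → subst (DelayedGameDomaticNumberIs (K n)) (sym (odd⇒[n+1]/2≡1+⌊n/2⌋ n odd))
                   (delayedGameDomaticNumber-K n))
  , (λ _ → subst (DelayedGameDomaticNumberIs (K n)) (sym ([n+2]/2≡1+⌊n/2⌋ n))
                 (delayedGameDomaticNumber-K n))
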